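{- Let $d$ be a positive integer and let $f\colon\mathbb{N}^d\to\mathbb{N}$ be any $d$-tupling function. A function $\sigma\colon\mathbb{N}^d\to\mathbb{N}$ is a shell numbering for $f$ if and only if, for all points $\mathbf{x}\in\mathbb{N}^d$, $$\bigl\lvert U_\sigma^{<n}\bigr\rvert\leq f(\mathbf{x})<\bigl\lvert U_\sigma^{<n+1}\bigr\rvert,\qquad\text{where } n=\sigma(\mathbf{x}).$$
   Context: $\mathbb{N}$ denotes the set of non-negative integers. A $d$-tupling function for $\mathbb{N}$ is a bijection from $\mathbb{N}^d$ to $\mathbb{N}$. Given a $d$-tupling function $f$, a function $\sigma\colon\mathbb{N}^d\to\mathbb{N}$ is a shell numbering for $f$ if and only if for all $\mathbf{x},\mathbf{y}\in\mathbb{N}^d$, $\sigma(\mathbf{x})<\sigma(\mathbf{y})$ implies $f(\mathbf{x})<f(\mathbf{y})$. For a function $\sigma\colon\mathbb{N}^d\to\mathbb{N}$ and $n\in\mathbb{N}$, $U_\sigma^{<n}$ denotes the set of all $\mathbf{y}\in\mathbb{N}^d$ with $\sigma(\mathbf{y})<n$. Convention for infinite cardinalities: if $U_\sigma^{<n}$ is infinite then $\lvert U_\sigma^{<n}\rvert\le i$ is false for every $i\in\mathbb{N}$; if $U_\sigma^{<n+1}$ is infinite then $i<\lvert U_\sigma^{<n+1}\rvert$ is true for every $i\in\mathbb{N}$. -}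

module Defs where

open import Data.Nat using (ℕ; suc; _<_)
open import Data.Fin using (Fin)
open import Data.Vec using (Vec)
open import Data.Product using (Σ; Σ-syntax; _×_)
open import Relation.Binary.PropositionalEquality using (_≡_)
open import Function.Definitions using (Bijective; Injective)

IsTupling : (d : ℕ) → (Vec ℕ d → ℕ) → Set
IsTupling d f = Bijective _≡_ _≡_ f

IsShellNumbering : {d : ℕ} → (Vec ℕ d → ℕ) → (Vec ℕ d → ℕ) → Set
IsShellNumbering {d} f σ = (x y : Vec ℕ d) → σ x < σ y → f x < f y

U< : {d : ℕ} → (Vec ℕ d → ℕ) → ℕ → Set
U< {d} σ n = Σ[ y ∈ Vec ℕ d ] (σ y < n)

-- |U_σ^{<n}| ≤ i : there is an injection U_σ^{<n} ↪ Fin i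
-- (injectivity on the underlying points). False when U is infinite.
CardU<≤ : {d : ℕ} → (Vec ℕ d → ℕ) → ℕ → ℕ → Set
CardU<≤ {d} σ n i =
  Σ[ g ∈ ((y : Vec ℕ d) → σ y < n → Fin i) ]
    ((y y′ : Vec ℕ d) (p : σ y < n) (p′ : σ y′ < n) → g y p ≡ g y′ p′ → y ≡ y′)

-- i < |U_σ^{<n}| : there is an injection Fin (i+1) ↪ U_σ^{<n}.
-- True for every i when U is infinite.
<CardU< : {d : ℕ} → (Vec ℕ d → ℕ) → ℕ → ℕ → Set
<CardU< {d} σ n i =
  Σ[ h ∈ (Fin (suc i) → Vec ℕ d) ]
    (((k : Fin (suc i)) → σ (h k) < n) × Injective _≡_ _≡_ h)

module Submission where

-- Write |U<n| for the size of U_σ^{<n} = {y | σ y < n}.  Two cardinality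
-- facts, valid for an arbitrary σ, drive the proof:
--   * comparison (pigeonhole): if i < |U<m|, |U<n| ≤ j and m ≤ n then i < j,
--     because U<m ⊆ U<n gives an injection Fin (1+i) ↪ Fin j;
--   * construction: an injective f bounded by i on U<n witnesses |U<n| ≤ i,
--     and a section g of f with σ (g k) < n for all k ≤ i witnesses i < |U<n|.
-- For (⇒), a shell numbering maps U<σx below f x (giving |U<σx| ≤ f x), and
-- conversely f y ≤ f x forces σ y ≤ σ x, so the preimages of 0..f x all lie
-- in U<(σx+1) (giving f x < |U<(σx+1)|).  For (⇐), if σ x < σ y then
-- comparison applied to f x < |U<(σx+1)| and |U<σy| ≤ f y yields f x < f y.
-- Only (⇒) uses that f is a bijection.

open import Defs
open import Data.Nat using (ℕ; suc; _≤_; _<_; _≮_; s≤s; s≤s⁻¹)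
open import Data.Nat.Properties using (<-≤-trans; ≮⇒≥; <⇒≱)
open import Data.Vec using (Vec)
open import Data.Product using (_×_; _,_; proj₁; proj₂)
open import Data.Fin using (Fin; toℕ; fromℕ<)
open import Data.Fin.Properties using (toℕ-injective; toℕ<n; fromℕ<-injective; injective⇒≤)
open import Function.Bundles using (_⇔_; mk⇔)
open import Function.Definitions using (Injective)
open import Relation.Binary.PropositionalEquality using (_≡_; refl; sym; trans; cong; subst)

module _ {d : ℕ} (σ : Vec ℕ d → ℕ) where

  -- Pigeonhole comparison of shell cardinalities: U<m ⊆ U<n when m ≤ n, so
  -- an injection Fin (1+i) ↪ U<m followed by U<n ↪ Fin j forces 1+i ≤ j.
  card-comparison : ∀ {m n i j} → m ≤ n → <CardU< σ m i → CardU<≤ σ n j → i < j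
  card-comparison {m} {n} {i} {j} m≤n (h , h-in , h-inj) (g , g-inj) = injective⇒≤ {f = g∘h} g∘h-inj
    where
    h-in-n : ∀ k → σ (h k) < n
    h-in-n k = <-≤-trans (h-in k) m≤n

    g∘h : Fin (suc i) → Fin j
    g∘h k = g (h k) (h-in-n k)

    g∘h-inj : Injective _≡_ _≡_ g∘h
    g∘h-inj {k} {k′} eq = h-inj (g-inj _ _ (h-in-n k) (h-in-n k′) eq)

  card≤-from-bound : ∀ {n i} (f : Vec ℕ d → ℕ) → Injective _≡_ _≡_ f →
    (∀ y → σ y < n → f y < i) → CardU<≤ σ n i
  card≤-from-bound {n} {i} f f-inj bound = g , g-inj
    where
    g : ∀ y → σ y < n → Fin i
    g y p = fromℕ< (bound y p)

    g-inj : ∀ y y′ p p′ → g y p ≡ g y′ p′ → y ≡ y′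
    g-inj y y′ p p′ eq = f-inj (fromℕ<-injective _ _ (bound y p) (bound y′ p′) eq)

  <card-from-section : ∀ {n i} (f : Vec ℕ d → ℕ) (g : ℕ → Vec ℕ d) →
    (∀ k → f (g k) ≡ k) → (∀ k → k ≤ i → σ (g k) < n) → <CardU< σ n i
  <card-from-section {n} {i} f g section into-U = h , h-in , h-inj
    where
    h : Fin (suc i) → Vec ℕ d
    h k = g (toℕ k)

    h-in : ∀ k → σ (h k) < n
    h-in k = into-U (toℕ k) (s≤s⁻¹ (toℕ<n k))

    h-inj : Injective _≡_ _≡_ h
    h-inj {k} {k′} eq =
      toℕ-injective (trans (sym (section (toℕ k))) (trans (cong f eq) (section (toℕ k′))))

shell-reflects-≤ : ∀ {d} {f σ : Vec ℕ d → ℕ} → IsShellNumbering f σ →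
  ∀ {x y} → f y ≤ f x → σ y ≤ σ x
shell-reflects-≤ {σ = σ} shell {x} {y} fy≤fx = ≮⇒≥ σx≮σy
  where
  σx≮σy : σ x ≮ σ y
  σx≮σy σx<σy = <⇒≱ (shell x y σx<σy) fy≤fx

ShellBounds : ∀ {d} → (f σ : Vec ℕ d → ℕ) → Set
ShellBounds f σ = ∀ x → CardU<≤ σ (σ x) (f x) × <CardU< σ (suc (σ x)) (f x)

shell⇒bounds : ∀ {d} (f σ : Vec ℕ d → ℕ) → IsTupling d f →
  IsShellNumbering f σ → ShellBounds f σ
shell⇒bounds {d} f σ (f-inj , f-surj) shell x =
  card≤-from-bound σ f f-inj (λ y σy<σx → shell y x σy<σx) ,
  <card-from-section σ f f⁻¹ section preimage-in-shell
  where
  f⁻¹ : ℕ → Vec ℕ d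
  f⁻¹ k = proj₁ (f-surj k)

  section : ∀ k → f (f⁻¹ k) ≡ k
  section k = proj₂ (f-surj k) refl

  preimage-in-shell : ∀ k → k ≤ f x → σ (f⁻¹ k) < suc (σ x)
  preimage-in-shell k k≤fx =
    s≤s (shell-reflects-≤ shell (subst (_≤ f x) (sym (section k)) k≤fx))

bounds⇒shell : ∀ {d} (f σ : Vec ℕ d → ℕ) → ShellBounds f σ → IsShellNumbering f σ
bounds⇒shell f σ bounds x y σx<σy =
  card-comparison σ σx<σy (proj₂ (bounds x)) (proj₁ (bounds y))

theorem4 : (d : ℕ) → 1 ≤ d → (f : Vec ℕ d → ℕ) → IsTupling d f →
    (σ : Vec ℕ d → ℕ) →
    IsShellNumbering f σ ⇔
    ((x : Vec ℕ d) → CardU<≤ σ (σ x) (f x) × <CardU< σ (suc (σ x)) (f x))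
theorem4 d _ f tupling σ = mk⇔ (shell⇒bounds f σ tupling) (bounds⇒shell f σ)
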